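{- Let $d$ be a positive integer, let $f\colon\mathbb{N}^d\to\mathbb{N}$ be a $d$-tupling function, and let $s\colon\mathbb{N}^d\to\mathbb{N}$ be a function such that $U_s^{<k}$ is finite for every $k\in\mathbb{N}$. If $f(\mathbf{x})<\bigl|U_s^{<s(\mathbf{x})+1}\bigr|$ for all $\mathbf{x}\in\mathbb{N}^d$, then $\bigl|U_s^{<s(\mathbf{x})}\bigr|\le f(\mathbf{x})$ for all $\mathbf{x}\in\mathbb{N}^d$.
   Context: $\mathbb{N}$ denotes the non-negative integers. A $d$-tupling function is a bijection $\mathbb{N}^d\to\mathbb{N}$. For $s\colon\mathbb{N}^d\to\mathbb{N}$ and $k\in\mathbb{N}$, $U_s^{<k}=\{\mathbf{y}\in\mathbb{N}^d : s(\mathbf{y})<k\}$. -}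

module Defs where

open import Data.Nat using (ℕ; _<_)
open import Data.Fin using (Fin)
open import Data.Vec using (Vec)
open import Data.Product using (Σ; ∃; proj₁)
open import Function.Bundles using (_⤖_)
open import Function.Definitions using (Bijective)
open import Relation.Binary.PropositionalEquality using (_≡_)

IsTupling : (d : ℕ) → (Vec ℕ d → ℕ) → Set
IsTupling d f = Bijective _≡_ _≡_ f

U< : {d : ℕ} → (Vec ℕ d → ℕ) → ℕ → Set
U< {d} s k = Σ (Vec ℕ d) (λ y → s y < k)

HasCard : Set → ℕ → Set
HasCard A n = A ⤖ Fin n

IsFinite : Set → Set
IsFinite A = ∃ λ n → HasCard A n

-- The cardinality of a finite type, read off from a finiteness witness
-- (independent of the witness, since Fin m ⤖ Fin n implies m ≡ n).
card : {A : Set} → IsFinite A → ℕ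
card = proj₁

module Submission where

-- Fix x, put k = s x and N = |U_s^{<k}|, and suppose,
-- for a contradiction, that f x < N.  Every y ∈ U_s^{<k} has s y + 1 ≤ k, so
-- by monotonicity of k ↦ |U_s^{<k}| and the hypothesis, f y < N as well.
-- Thus f restricted to U_s^{<k} is an injection into {0, …, N-1}; its image
-- misses f x, because x ∉ U_s^{<k} and f is injective.  Hence the N elements
-- of U_s^{<k} together with x are N + 1 distinct values below N, which is
-- impossible.

open import Defs
open import Data.Nat using (ℕ; suc; _<_; _≤_)
open import Data.Nat.Properties using (<-irrelevant; <-≤-trans; <-irrefl; ≰⇒>; _≤?_)
open import Data.Vec using (Vec)
open import Data.Fin using (Fin; zero; suc; toℕ; fromℕ<)
open import Data.Fin.Properties using (injective⇒≤; fromℕ<-injective; toℕ<n; toℕ-injective)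
open import Data.Product using (_,_; proj₁; proj₂)
open import Data.Empty using (⊥-elim)
open import Function using (_∘_)
open import Function.Bundles using (Bijection)
open import Function.Definitions using (Injective)
open import Relation.Binary.PropositionalEquality using (_≡_; _≢_; refl; sym; trans; cong; subst)
open import Relation.Nullary using (yes; no)

fin-bounded-injection⇒≤ : {n m : ℕ} (g : Fin n → ℕ) → Injective _≡_ _≡_ g →
  (∀ i → g i < m) → n ≤ m
fin-bounded-injection⇒≤ {n} {m} g g-inj g<m = injective⇒≤ {f = g′} g′-inj
  where
  g′ : Fin n → Fin m
  g′ i = fromℕ< (g<m i)
  g′-inj : Injective _≡_ _≡_ g′
  g′-inj {i} {j} eq = g-inj (fromℕ<-injective (g i) (g j) (g<m i) (g<m j) eq)

module Enumeration {A : Set} {n : ℕ} (e : HasCard A n) where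
  open Bijection e using (to; strictlySurjective)

  elem : Fin n → A
  elem i = proj₁ (strictlySurjective i)

  elem-injective : Injective _≡_ _≡_ elem
  elem-injective {i} {j} eq =
    trans (sym (proj₂ (strictlySurjective i)))
          (trans (cong to eq) (proj₂ (strictlySurjective j)))

card-bounded-injection⇒≤ : {A : Set} {n m : ℕ} → HasCard A n →
  (h : A → ℕ) → Injective _≡_ _≡_ h → (∀ a → h a < m) → n ≤ m
card-bounded-injection⇒≤ e h h-inj h<m =
  fin-bounded-injection⇒≤ (h ∘ elem) (elem-injective ∘ h-inj) (h<m ∘ elem)
  where open Enumeration e

-- Sharpened counting principle: if the injection also misses some p < m,
-- then adjoining p as an extra point gives n + 1 distinct values below m.
card-bounded-injection-avoiding⇒< : {A : Set} {n m : ℕ} → HasCard A n →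
  (h : A → ℕ) → Injective _≡_ _≡_ h → (∀ a → h a < m) →
  (p : ℕ) → p < m → (∀ a → h a ≢ p) → n < m
card-bounded-injection-avoiding⇒< {n = n} {m} e h h-inj h<m p p<m avoids =
  fin-bounded-injection⇒≤ g g-inj g<m
  where
  open Enumeration e
  g : Fin (suc n) → ℕ
  g zero    = p
  g (suc i) = h (elem i)
  g<m : ∀ i → g i < m
  g<m zero    = p<m
  g<m (suc i) = h<m (elem i)
  g-inj : Injective _≡_ _≡_ g
  g-inj {zero}  {zero}  _  = refl
  g-inj {zero}  {suc j} eq = ⊥-elim (avoids (elem j) (sym eq))
  g-inj {suc i} {zero}  eq = ⊥-elim (avoids (elem i) eq)
  g-inj {suc i} {suc j} eq = cong suc (elem-injective (h-inj eq))

module _ {d : ℕ} (s : Vec ℕ d → ℕ) where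

  U<-≡ : {k : ℕ} {a b : U< s k} → proj₁ a ≡ proj₁ b → a ≡ b
  U<-≡ {a = y , p} {b = .y , q} refl = cong (y ,_) (<-irrelevant p q)

  injective-on-U< : {k : ℕ} (f : Vec ℕ d → ℕ) → Injective _≡_ _≡_ f →
    Injective _≡_ _≡_ (λ (a : U< s k) → f (proj₁ a))
  injective-on-U< f f-inj eq = U<-≡ (f-inj eq)

  -- |U_s^{<k}| is monotone in k: U_s^{<a} ⊆ U_s^{<b} for a ≤ b, and this
  -- inclusion, read through an enumeration of U_s^{<b}, is an injection
  -- into {0, …, |U_s^{<b}| - 1}.
  card-U<-mono : (fin : (k : ℕ) → IsFinite (U< s k)) {a b : ℕ} → a ≤ b →
    card (fin a) ≤ card (fin b)
  card-U<-mono fin {a} {b} a≤b =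
    card-bounded-injection⇒≤ (proj₂ (fin a)) index index-inj (λ _ → toℕ<n _)
    where
    open Bijection (proj₂ (fin b)) using (to; injective)
    index : U< s a → ℕ
    index (y , sy<a) = toℕ (to (y , <-≤-trans sy<a a≤b))
    index-inj : Injective _≡_ _≡_ index
    index-inj eq = U<-≡ (cong proj₁ (injective (toℕ-injective eq)))

lemma2p3 : (d : ℕ) → 1 ≤ d → (f : Vec ℕ d → ℕ) → IsTupling d f →
    (s : Vec ℕ d → ℕ) → (fin : (k : ℕ) → IsFinite (U< s k)) →
    ((x : Vec ℕ d) → f x < card (fin (suc (s x)))) →
    (x : Vec ℕ d) → card (fin (s x)) ≤ f x
lemma2p3 d _ f (f-inj , _) s fin f<card x with card (fin (s x)) ≤? f x
... | yes N≤fx = N≤fx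
... | no N≰fx = ⊥-elim (<-irrefl refl N<N)
  where
  -- Every y ∈ U_s^{<s x} has f y < |U_s^{<s y + 1}| ≤ |U_s^{<s x}|.
  f<N : (a : U< s (s x)) → f (proj₁ a) < card (fin (s x))
  f<N (y , sy<sx) = <-≤-trans (f<card y) (card-U<-mono s fin sy<sx)
  -- f y = f x would give y = x, contradicting s y < s x.
  avoids-fx : (a : U< s (s x)) → f (proj₁ a) ≢ f x
  avoids-fx (y , sy<sx) fy≡fx = <-irrefl refl (subst (λ z → s z < s x) (f-inj fy≡fx) sy<sx)
  N<N : card (fin (s x)) < card (fin (s x))
  N<N = card-bounded-injection-avoiding⇒< (proj₂ (fin (s x))) (f ∘ proj₁)
          (injective-on-U< s f f-inj) f<N (f x) (≰⇒> N≰fx) avoids-fx
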